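{- Let $G$ be a galactic graph with planets $A$ and let $I_s,I_t$ be galactic independent sets of size $k$ such that, for every black hole $b$, at most one planet of $N(b)\cap A$ carries a token in $I_s$ and at most one carries a token in $I_t$. If there exists a sequence of slides transforming $I_s$ into $I_t$, then there exists such a sequence $I_s=I_0,I_1,\dots,I_\ell=I_t$ in which, for every $i$ and every black hole $b$, at most one planet of $N(b)\cap A$ carries a token in $I_i$.
   Context: A galactic graph is a simple graph $G$ whose vertex set is partitioned into planets $A(G)$ and black holes $B(G)$. A galactic independent set of size $k$ is a weight function $\omega:V(G)\to\{0,\dots,k\}$ (number of tokens per vertex) with $\sum_v\omega(v)=k$, $\omega(v)\le 1$ for planets, and such that the planets carrying a token form an independent set of $G$. A slide moves one token from a vertex to a neighbor, provided the result is again a galactic independent set. -}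

module Defs where

open import Data.Nat using (ℕ; zero; suc; _+_; _∸_; _≤_)
open import Data.Fin using (Fin; zero; suc)
open import Data.Bool using (Bool; true; false)
open import Data.Product using (_×_; Σ; ∃-syntax)
open import Data.List using (List; []; _∷_)
open import Relation.Binary.PropositionalEquality using (_≡_)
open import Relation.Nullary using (¬_)

record GalacticGraph (n : ℕ) : Set where
  field
    adj      : Fin n → Fin n → Bool
    sym-adj  : ∀ u v → adj u v ≡ adj v u
    irrefl   : ∀ v → adj v v ≡ false
    isPlanet : Fin n → Bool

open GalacticGraph public

Adj : ∀ {n} → GalacticGraph n → Fin n → Fin n → Set
Adj G u v = adj G u v ≡ true

Planet : ∀ {n} → GalacticGraph n → Fin n → Set
Planet G v = isPlanet G v ≡ true

BlackHole : ∀ {n} → GalacticGraph n → Fin n → Set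
BlackHole G v = isPlanet G v ≡ false

-- Weight functions (number of tokens on each vertex)
Weight : ℕ → Set
Weight n = Fin n → ℕ

total : ∀ {n} → Weight n → ℕ
total {zero}  ω = 0
total {suc n} ω = ω zero + total (λ i → ω (suc i))

record IsGIS {n} (G : GalacticGraph n) (k : ℕ) (ω : Weight n) : Set where
  field
    size       : total ω ≡ k
    planet≤1   : ∀ v → Planet G v → ω v ≤ 1
    independent : ∀ u v → Planet G u → Planet G v →
                  1 ≤ ω u → 1 ≤ ω v → ¬ Adj G u v

-- ω' is obtained from ω by sliding one token from u to a neighbour v
-- (u ≠ v automatically since the graph is irreflexive).
SlideAlong : ∀ {n} → GalacticGraph n → Weight n → Fin n → Fin n → Weight n → Set
SlideAlong G ω u v ω' =
  Adj G u v × 1 ≤ ω u × ω' u ≡ ω u ∸ 1 × ω' v ≡ suc (ω v) ×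
  (∀ w → ¬ w ≡ u → ¬ w ≡ v → ω' w ≡ ω w)

Slide : ∀ {n} → GalacticGraph n → ℕ → Weight n → Weight n → Set
Slide G k ω ω' = IsGIS G k ω × IsGIS G k ω' × ∃[ u ] ∃[ v ] SlideAlong G ω u v ω'

-- A sequence of slides I₀ = ω, I₁, …, I_ℓ = ω', given as the list
-- [I₀, …, I_ℓ] of configurations, each consecutive pair related by a slide.
data SlideSeq {n} (G : GalacticGraph n) (k : ℕ) : Weight n → List (Weight n) → Weight n → Set where
  done : ∀ {ω} → IsGIS G k ω → SlideSeq G k ω (ω ∷ []) ω
  step : ∀ {ω ω₁ ω' is} → Slide G k ω ω₁ → SlideSeq G k ω₁ is ω' →
         SlideSeq G k ω (ω ∷ is) ω'

BHGood : ∀ {n} → GalacticGraph n → Weight n → Set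
BHGood G ω = ∀ b → BlackHole G b → ∀ p q →
  Planet G p → Planet G q → Adj G b p → Adj G b q →
  1 ≤ ω p → 1 ≤ ω q → p ≡ q

-- Call a planet exposed if it is adjacent to a black hole. Alongside the given
-- sequence I₀, …, I_ℓ we run a shadow sequence of configurations J in which
-- every token of I on an exposed planet is parked on an adjacent black hole:
-- J + departures = I + arrivals pointwise, for a list of (planet, black hole)
-- pairs. A shadow with no token on an exposed planet satisfies the black-hole
-- condition trivially. A slide u → v of I is imitated by fetching the token of
-- u back from its black hole if it is parked, sliding it to v, and parking it
-- again if v is exposed; in between, u (resp. v) is the only exposed planet
-- that may carry a token. On planets, every configuration of the initial
-- parking and of the final unparking carries a subset of the tokens of I_s,
-- resp. I_t, and so inherits the black-hole condition from it. Throughout, a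
-- slide u → v from J to J' is handled as the pointwise balance
-- J' + δ u = J + δ v.
module Submission where

open import Defs
open import Algebra.Properties.CommutativeSemigroup
  using (interchange; xy∙z≈xz∙y; xy∙z≈x∙zy; x∙yz≈xz∙y)
open import Data.Bool using (true; false)
open import Data.Bool.Properties using () renaming (_≟_ to _≟ᴮ_)
open import Data.Empty using (⊥-elim)
open import Data.Fin using (Fin; zero; suc; _≟_)
open import Data.Fin.Properties using (any?)
open import Data.List using (List; []; _∷_; map; length; allFin)
open import Data.List.Properties using (length-map)
open import Data.List.Membership.Propositional using (_∉_)
open import Data.List.Membership.Propositional.Properties using (∈-allFin)
open import Data.List.Relation.Binary.Permutation.Propositional using (_↭_; prep; swap; ↭-refl; ↭-trans)
open import Data.List.Relation.Binary.Permutation.Propositional.Properties using (All-resp-↭; map⁺)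
open import Data.List.Relation.Unary.All using (All; []; _∷_)
open import Data.List.Relation.Unary.Any using (here; there)
open import Data.Nat using (ℕ; zero; suc; _+_; _∸_; _≤_; z≤n; s≤s)
open import Data.Nat.ListAction using (sum)
open import Data.Nat.ListAction.Properties using (sum-↭)
open import Data.Nat.Properties
  using (+-assoc; +-comm; +-suc; +-identityʳ; +-cancelʳ-≡; +-commutativeSemigroup;
         ≤-trans; ≤-reflexive; m≤m+n; m∸n≤m; m∸n+n≡m; m≤n⇒m∸n≡0; <⇒≢)
open import Data.Product using (∃-syntax; ∃₂; _×_; _,_; proj₁; proj₂)
open import Function using (_∘_)
open import Relation.Binary.Construct.Closure.ReflexiveTransitive using (Star; ε; _◅_; _◅◅_)
open import Relation.Binary.Construct.Closure.Transitive using (TransClosure; [_]; _∷_; _∷ʳ_)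
open import Relation.Binary.PropositionalEquality hiding (J)
open import Relation.Nullary using (yes; no; contradiction)
open import Relation.Nullary.Decidable using (_×-dec_)
open import Relation.Unary using (Decidable)

open ≡-Reasoning

private
  variable
    n : ℕ

-- Read  a + x ≡ b + y  as  a − b = y − x  in ℤ.
offset-trans : ∀ {a b c x y z t} → a + x ≡ b + y → b + z ≡ c + t → a + (x + z) ≡ c + (y + t)
offset-trans {a} {b} {c} {x} {y} {z} {t} e f = begin
  a + (x + z)  ≡⟨ sym (+-assoc a x z) ⟩
  a + x + z    ≡⟨ cong (_+ z) e ⟩
  b + y + z    ≡⟨ xy∙z≈xz∙y +-commutativeSemigroup b y z ⟩
  b + z + y    ≡⟨ cong (_+ y) f ⟩
  c + t + y    ≡⟨ xy∙z≈x∙zy +-commutativeSemigroup c t y ⟩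
  c + (y + t)  ∎

offset-cancel : ∀ {a b c x y z t} → a + x ≡ b + y → b + (y + z) ≡ c + (x + t) → a + z ≡ c + t
offset-cancel {a} {b} {c} {x} {y} {z} {t} e f = +-cancelʳ-≡ x (a + z) (c + t) (begin
  a + z + x    ≡⟨ xy∙z≈xz∙y +-commutativeSemigroup a z x ⟩
  a + x + z    ≡⟨ cong (_+ z) e ⟩
  b + y + z    ≡⟨ +-assoc b y z ⟩
  b + (y + z)  ≡⟨ f ⟩
  c + (x + t)  ≡⟨ x∙yz≈xz∙y +-commutativeSemigroup c x t ⟩
  c + t + x    ∎)

∉-∷ : ∀ {A : Set} {p x : A} {L : List A} → p ≢ x → p ∉ L → p ∉ x ∷ L
∉-∷ p≢x p∉L (here p≡x)  = p≢x p≡x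
∉-∷ p≢x p∉L (there p∈L) = p∉L p∈L

δ : Fin n → Weight n
δ zero    zero    = 1
δ zero    (suc _) = 0
δ (suc _) zero    = 0
δ (suc x) (suc y) = δ x y

δ-same : (x : Fin n) → δ x x ≡ 1
δ-same zero    = refl
δ-same (suc x) = δ-same x

δ-≢ : {x y : Fin n} → x ≢ y → δ x y ≡ 0
δ-≢ {x = zero}  {zero}  x≢y = contradiction refl x≢y
δ-≢ {x = zero}  {suc _} _   = refl
δ-≢ {x = suc _} {zero}  _   = refl
δ-≢ {x = suc x} {suc y} x≢y = δ-≢ (x≢y ∘ cong suc)

δ-≤ : {f : Weight n} {x : Fin n} → 1 ≤ f x → ∀ w → δ x w ≤ f w
δ-≤ {f = f} {x} 1≤fx w with x ≟ w
... | yes refl = subst (_≤ f x) (sym (δ-same x)) 1≤fx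
... | no x≢w   = subst (_≤ f w) (sym (δ-≢ x≢w)) z≤n

total-cong : {f g : Weight n} → f ≗ g → total f ≡ total g
total-cong {zero}  f≗g = refl
total-cong {suc n} f≗g = cong₂ _+_ (f≗g zero) (total-cong (f≗g ∘ suc))

total-+ : (f g : Weight n) → total (λ w → f w + g w) ≡ total f + total g
total-+ {zero}  f g = refl
total-+ {suc n} f g = begin
  f zero + g zero + total (λ w → f (suc w) + g (suc w))
    ≡⟨ cong (f zero + g zero +_) (total-+ (f ∘ suc) (g ∘ suc)) ⟩
  f zero + g zero + (total (f ∘ suc) + total (g ∘ suc))
    ≡⟨ interchange +-commutativeSemigroup (f zero) (g zero) (total (f ∘ suc)) (total (g ∘ suc)) ⟩
  f zero + total (f ∘ suc) + (g zero + total (g ∘ suc))  ∎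

total-0 : total {n} (λ _ → 0) ≡ 0
total-0 {zero}  = refl
total-0 {suc n} = total-0 {n}

total-δ : (x : Fin n) → total (δ x) ≡ 1
total-δ {suc n} zero    = cong suc (total-0 {n})
total-δ         (suc x) = total-δ x

occurrences : List (Fin n) → Weight n
occurrences xs w = sum (map (λ x → δ x w) xs)

total-occurrences : (xs : List (Fin n)) → total (occurrences xs) ≡ length xs
total-occurrences {n} []   = total-0 {n}
total-occurrences (x ∷ xs) = begin
  total (λ w → δ x w + occurrences xs w)  ≡⟨ total-+ (δ x) (occurrences xs) ⟩
  total (δ x) + total (occurrences xs)    ≡⟨ cong₂ _+_ (total-δ x) (total-occurrences xs) ⟩
  suc (length xs)                         ∎

occurrences-↭ : {xs ys : List (Fin n)} → xs ↭ ys → occurrences xs ≗ occurrences ys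
occurrences-↭ xs↭ys w = sum-↭ (map⁺ (λ x → δ x w) xs↭ys)

moved : Fin n → Fin n → Weight n → Weight n
moved u v J w = J w + δ v w ∸ δ u w

moved-balance : {u v : Fin n} {J : Weight n} → 1 ≤ J u →
                ∀ w → moved u v J w + δ u w ≡ J w + δ v w
moved-balance {J = J} 1≤Ju w = m∸n+n≡m (≤-trans (δ-≤ {f = J} 1≤Ju w) (m≤m+n (J w) _))

module Parking {n : ℕ} (G : GalacticGraph n) where

  Parkings : Set
  Parkings = List (Fin n × Fin n)

  private
    variable
      I I' J J' K L T : Weight n
      M M' : Parkings
      b p u v x β : Fin n
      Xs : List (Fin n)

  Adj⇒≢ : Adj G u v → u ≢ v
  Adj⇒≢ {u = u} uv refl with trans (sym uv) (irrefl G u)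
  ... | ()

  Adj-sym : Adj G u v → Adj G v u
  Adj-sym {u = u} {v = v} uv = trans (sym-adj G v u) uv

  Planet⇒≢BlackHole : Planet G p → BlackHole G b → p ≢ b
  Planet⇒≢BlackHole pp bb refl with trans (sym pp) bb
  ... | ()

  slideAlong-source : SlideAlong G J u v J' → J' u ≡ J u ∸ 1
  slideAlong-source (_ , _ , J'u , _ , _) = J'u

  slideAlong-target : SlideAlong G J u v J' → J' v ≡ suc (J v)
  slideAlong-target (_ , _ , _ , J'v , _) = J'v

  slideAlong-frame : SlideAlong G J u v J' → ∀ w → w ≢ u → w ≢ v → J' w ≡ J w
  slideAlong-frame (_ , _ , _ , _ , frame) = frame

  slideAlong⇒balance : SlideAlong G J u v J' → ∀ w → J' w + δ u w ≡ J w + δ v w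
  slideAlong⇒balance {J = J} {u = u} {v = v} {J' = J'} (uv , 1≤Ju , J'u , J'v , frame) w
    with w ≟ u | w ≟ v
  ... | yes refl | _ = begin
    J' u + δ u u   ≡⟨ cong₂ _+_ J'u (δ-same u) ⟩
    J u ∸ 1 + 1    ≡⟨ m∸n+n≡m 1≤Ju ⟩
    J u            ≡⟨ sym (+-identityʳ (J u)) ⟩
    J u + 0        ≡⟨ cong (J u +_) (sym (δ-≢ (Adj⇒≢ uv ∘ sym))) ⟩
    J u + δ v u    ∎
  ... | no w≢u | yes refl = begin
    J' v + δ u v   ≡⟨ cong₂ _+_ J'v (δ-≢ (Adj⇒≢ uv)) ⟩
    suc (J v) + 0  ≡⟨ +-comm (suc (J v)) 0 ⟩
    suc (J v)      ≡⟨ +-comm 1 (J v) ⟩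
    J v + 1        ≡⟨ cong (J v +_) (sym (δ-same v)) ⟩
    J v + δ v v    ∎
  ... | no w≢u | no w≢v =
    cong₂ _+_ (frame w w≢u w≢v) (trans (δ-≢ (w≢u ∘ sym)) (sym (δ-≢ (w≢v ∘ sym))))

  balance⇒slideAlong : Adj G u v → (∀ w → J' w + δ u w ≡ J w + δ v w) → SlideAlong G J u v J'
  balance⇒slideAlong {u = u} {v = v} {J' = J'} {J = J} uv balanced =
    uv , subst (1 ≤_) (sym Ju) (s≤s z≤n) , cong (_∸ 1) (sym Ju) , J'v , frame
    where
    at : ∀ w {a c} → δ u w ≡ a → δ v w ≡ c → J' w + a ≡ J w + c
    at w δu δv = subst₂ (λ a c → J' w + a ≡ J w + c) δu δv (balanced w)
    Ju : J u ≡ suc (J' u)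
    Ju = trans (sym (+-identityʳ (J u)))
               (trans (sym (at u (δ-same u) (δ-≢ (Adj⇒≢ uv ∘ sym)))) (+-comm (J' u) 1))
    J'v : J' v ≡ suc (J v)
    J'v = trans (sym (+-identityʳ (J' v)))
                (trans (at v (δ-≢ (Adj⇒≢ uv)) (δ-same v)) (+-comm (J v) 1))
    frame : ∀ w → w ≢ u → w ≢ v → J' w ≡ J w
    frame w w≢u w≢v = +-cancelʳ-≡ 0 (J' w) (J w) (at w (δ-≢ (w≢u ∘ sym)) (δ-≢ (w≢v ∘ sym)))

  moved-slideAlong : Adj G u v → 1 ≤ J u → SlideAlong G J u v (moved u v J)
  moved-slideAlong {u = u} {v = v} {J = J} uv 1≤Ju =
    balance⇒slideAlong uv (moved-balance {u = u} {v} {J} 1≤Ju)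

  slideAlong-≗ : SlideAlong G J u v K → K ≗ L → SlideAlong G J u v L
  slideAlong-≗ {u = u} s@(uv , _) K≗L =
    balance⇒slideAlong uv (λ w → trans (cong (_+ δ u w) (sym (K≗L w))) (slideAlong⇒balance s w))

  _⊑_ : Weight n → Weight n → Set
  J ⊑ I = ∀ p → Planet G p → J p ≤ I p

  BHGood-⊑ : J ⊑ I → BHGood G I → BHGood G J
  BHGood-⊑ J⊑I good b bb p q pp pq bp bq 1≤Jp 1≤Jq =
    good b bb p q pp pq bp bq (≤-trans 1≤Jp (J⊑I p pp)) (≤-trans 1≤Jq (J⊑I q pq))

  IsGIS-⊑ : ∀ {k} → J ⊑ I → total J ≡ k → IsGIS G k I → IsGIS G k J
  IsGIS-⊑ J⊑I size gis = record
    { size        = size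
    ; planet≤1    = λ p pp → ≤-trans (J⊑I p pp) (IsGIS.planet≤1 gis p pp)
    ; independent = λ p q pp pq 1≤Jp 1≤Jq →
        IsGIS.independent gis p q pp pq (≤-trans 1≤Jp (J⊑I p pp)) (≤-trans 1≤Jq (J⊑I q pq))
    }

  slideAlong-empties-planet : ∀ {k} → IsGIS G k J → Planet G u → SlideAlong G J u v J' → J' u ≡ 0
  slideAlong-empties-planet {u = u} gis pu s =
    trans (slideAlong-source s) (m≤n⇒m∸n≡0 (IsGIS.planet≤1 gis u pu))

  parking-frame : SlideAlong G J x β J' → BlackHole G β →
                  ∀ p → Planet G p → p ≢ x → J' p ≡ J p
  parking-frame s bβ p pp p≢x = slideAlong-frame s p p≢x (Planet⇒≢BlackHole pp bβ)

  parking-⊑ : SlideAlong G J x β J' → BlackHole G β → J' ⊑ J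
  parking-⊑ {J = J} {x = x} s bβ p pp with p ≟ x
  ... | yes refl = subst (_≤ J p) (sym (slideAlong-source s)) (m∸n≤m (J p) 1)
  ... | no p≢x   = ≤-reflexive (parking-frame s bβ p pp p≢x)

  Exposed : Fin n → Set
  Exposed p = Planet G p × ∃[ b ] (BlackHole G b × Adj G b p)

  exposed? : Decidable Exposed
  exposed? p =
    (isPlanet G p ≟ᴮ true) ×-dec
    any? (λ b → (isPlanet G b ≟ᴮ false) ×-dec (adj G b p ≟ᴮ true))

  ClearOutside : List (Fin n) → Weight n → Set
  ClearOutside Xs J = ∀ p → Exposed p → p ∉ Xs → J p ≡ 0

  Clear : Weight n → Set
  Clear = ClearOutside []

  Clear⇒BHGood : Clear J → BHGood G J
  Clear⇒BHGood clear b bb p q pp pq bp bq 1≤Jp 1≤Jq =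
    contradiction (sym (clear p (pp , b , bb , bp) λ ())) (<⇒≢ 1≤Jp)

  ClearOutside-∷[]⇒BHGood : ClearOutside (x ∷ []) J → BHGood G J
  ClearOutside-∷[]⇒BHGood {x = x} {J = J} clear b bb p q pp pq bp bq 1≤Jp 1≤Jq =
    trans (is-x p (pp , b , bb , bp) 1≤Jp) (sym (is-x q (pq , b , bb , bq) 1≤Jq))
    where
    is-x : ∀ p → Exposed p → 1 ≤ J p → p ≡ x
    is-x p ex 1≤Jp with p ≟ x
    ... | yes p≡x = p≡x
    ... | no p≢x  = contradiction (sym (clear p ex (∉-∷ p≢x λ ()))) (<⇒≢ 1≤Jp)

  ClearOutside-∷ : ClearOutside (x ∷ Xs) J → (Exposed x → J' x ≡ 0) →
                   (∀ p → Planet G p → p ≢ x → J' p ≡ J p) → ClearOutside Xs J'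
  ClearOutside-∷ {x = x} clear J'x≡0 frame p ex p∉Xs with p ≟ x
  ... | yes refl = J'x≡0 ex
  ... | no p≢x   = trans (frame p (proj₁ ex) p≢x) (clear p ex (∉-∷ p≢x p∉Xs))

  Parkable : Fin n × Fin n → Set
  Parkable (p , b) = Planet G p × BlackHole G b × Adj G b p

  departures arrivals : Parkings → Weight n
  departures M = occurrences (map proj₁ M)
  arrivals   M = occurrences (map proj₂ M)

  -- J is I with, for each (p , b) in M, one token moved from the planet p to the black hole b.
  record Parked (I : Weight n) (M : Parkings) (J : Weight n) : Set where
    field
      balance  : ∀ w → J w + departures M w ≡ I w + arrivals M w
      parkable : All Parkable M
  open Parked

  departures-BlackHole : All Parkable M → BlackHole G b → departures M b ≡ 0
  departures-BlackHole []                  bb = refl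
  departures-BlackHole ((pp , _ , _) ∷ ok) bb =
    cong₂ _+_ (δ-≢ (Planet⇒≢BlackHole pp bb)) (departures-BlackHole ok bb)

  arrivals-Planet : All Parkable M → Planet G p → arrivals M p ≡ 0
  arrivals-Planet []                  pp = refl
  arrivals-Planet ((_ , bb , _) ∷ ok) pp =
    cong₂ _+_ (δ-≢ (Planet⇒≢BlackHole pp bb ∘ sym)) (arrivals-Planet ok pp)

  parked-refl : Parked I [] I
  parked-refl = record { balance = λ w → refl ; parkable = [] }

  parked-[] : Parked I [] J → J ≗ I
  parked-[] P w = +-cancelʳ-≡ 0 _ _ (balance P w)

  parked-head : Parked I ((p , b) ∷ M) J → Parkable (p , b)
  parked-head P with parkable P
  ... | ok ∷ _ = ok

  parked-⊑ : Parked I M J → J ⊑ I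
  parked-⊑ {I = I} {M = M} {J = J} P p pp =
    ≤-trans (m≤m+n (J p) (departures M p)) (≤-reflexive (begin
      J p + departures M p  ≡⟨ balance P p ⟩
      I p + arrivals M p    ≡⟨ cong (I p +_) (arrivals-Planet (parkable P) pp) ⟩
      I p + 0               ≡⟨ +-identityʳ (I p) ⟩
      I p                   ∎))

  parked-total : Parked I M J → total J ≡ total I
  parked-total {I = I} {M = M} {J = J} P = +-cancelʳ-≡ (length M) (total J) (total I) (begin
    total J + length M                  ≡⟨ cong (total J +_) (sym (total-occurrences-map proj₁)) ⟩
    total J + total (departures M)      ≡⟨ sym (total-+ J (departures M)) ⟩
    total (λ w → J w + departures M w)  ≡⟨ total-cong (balance P) ⟩
    total (λ w → I w + arrivals M w)    ≡⟨ total-+ I (arrivals M) ⟩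
    total I + total (arrivals M)        ≡⟨ cong (total I +_) (total-occurrences-map proj₂) ⟩
    total I + length M                  ∎)
    where
    total-occurrences-map : (f : Fin n × Fin n → Fin n) → total (occurrences (map f M)) ≡ length M
    total-occurrences-map f = trans (total-occurrences (map f M)) (length-map f M)

  parked-IsGIS : ∀ {k} → IsGIS G k I → Parked I M J → IsGIS G k J
  parked-IsGIS gis P = IsGIS-⊑ (parked-⊑ P) (trans (parked-total P) (IsGIS.size gis)) gis

  parked-BHGood : BHGood G I → Parked I M J → BHGood G J
  parked-BHGood good P = BHGood-⊑ (parked-⊑ P) good

  parked-slide : Parked I M J → SlideAlong G I u v I' → SlideAlong G J u v J' → Parked I' M J'
  parked-slide {I = I} {J = J} {I' = I'} {J' = J'} P sI sJ = record
    { balance  = λ w →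
        sym (offset-cancel {I' w} {I w} {J' w} (slideAlong⇒balance sI w)
               (sym (offset-trans {J' w} {J w} {I w} (slideAlong⇒balance sJ w) (balance P w))))
    ; parkable = parkable P
    }

  parked-park : Parked I M J → Parkable (p , b) → SlideAlong G J p b J' → Parked I ((p , b) ∷ M) J'
  parked-park {I = I} {J = J} {J' = J'} P ok s = record
    { balance  = λ w → offset-trans {J' w} {J w} {I w} (slideAlong⇒balance s w) (balance P w)
    ; parkable = ok ∷ parkable P
    }

  parked-unpark : Parked I ((p , b) ∷ M) J → SlideAlong G J b p J' → Parked I M J'
  parked-unpark {I = I} {J = J} {J' = J'} P s with parkable P
  ... | _ ∷ ok = record
    { balance  = λ w → offset-cancel {J' w} {J w} {I w} (slideAlong⇒balance s w) (balance P w)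
    ; parkable = ok
    }

  parked-↭ : Parked I M J → M ↭ M' → Parked I M' J
  parked-↭ {I = I} {J = J} P M↭M' = record
    { balance  = λ w → trans (cong (J w +_) (sym (occurrences-↭ (map⁺ proj₁ M↭M') w)))
                             (trans (balance P w) (cong (I w +_) (occurrences-↭ (map⁺ proj₂ M↭M') w)))
    ; parkable = All-resp-↭ M↭M' (parkable P)
    }

  departures-↭ : 1 ≤ departures M u → ∃₂ λ b M' → M ↭ (u , b) ∷ M'
  departures-↭ {M = (p , b) ∷ M} {u} 1≤dep with p ≟ u
  ... | yes refl = b , M , ↭-refl
  ... | no p≢u with departures-↭ {M = M} (subst (λ d → 1 ≤ d + departures M u) (δ-≢ p≢u) 1≤dep)
  ...   | b' , M' , M↭ =
    b' , (p , b) ∷ M' , ↭-trans (prep (p , b) M↭) (swap (p , b) (u , b') ↭-refl)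

  parked-departure : Parked I M J → 1 ≤ departures M u → ∃₂ λ b M' → Parked I ((u , b) ∷ M') J
  parked-departure P 1≤dep with departures-↭ 1≤dep
  ... | b , M' , M↭ = b , M' , parked-↭ P M↭

  parked-missing : Parked I M J → J u ≡ 0 → 1 ≤ I u → 1 ≤ departures M u
  parked-missing {I = I} {M = M} {u = u} P Ju≡0 1≤Iu =
    ≤-trans 1≤Iu (≤-trans (m≤m+n (I u) (arrivals M u))
                          (≤-reflexive (sym (trans (cong (_+ departures M u) (sym Ju≡0)) (balance P u)))))

  parked-occupied : Parked I ((p , b) ∷ M) J → 1 ≤ J b
  parked-occupied {I = I} {p = p} {b = b} {M = M} {J = J} P with parkable P
  ... | (pp , bb , _) ∷ ok = subst (1 ≤_) (sym Jb) (s≤s z≤n)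
    where
    nothing-leaves-b : δ p b + departures M b ≡ 0
    nothing-leaves-b = cong₂ _+_ (δ-≢ (Planet⇒≢BlackHole pp bb)) (departures-BlackHole ok bb)
    Jb : J b ≡ suc (I b + arrivals M b)
    Jb = begin
      J b                             ≡⟨ sym (+-identityʳ (J b)) ⟩
      J b + 0                         ≡⟨ cong (J b +_) (sym nothing-leaves-b) ⟩
      J b + (δ p b + departures M b)  ≡⟨ balance P b ⟩
      I b + (δ b b + arrivals M b)    ≡⟨ cong (λ d → I b + (d + arrivals M b)) (δ-same b) ⟩
      I b + suc (arrivals M b)        ≡⟨ +-suc (I b) (arrivals M b) ⟩
      suc (I b + arrivals M b)        ∎

  unparking-slideAlong : Parked I ((p , b) ∷ M) J → SlideAlong G J b p (moved b p J)
  unparking-slideAlong P = moved-slideAlong (proj₂ (proj₂ (parked-head P))) (parked-occupied P)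

  module Simulation (k : ℕ) where

    GoodSlide : Weight n → Weight n → Set
    GoodSlide J K = Slide G k J K × BHGood G J × BHGood G K

    _⇝*_ _⇝⁺_ : Weight n → Weight n → Set
    _⇝*_ = Star GoodSlide
    _⇝⁺_ = TransClosure GoodSlide

    infixr 5 _◅◅⁺_ _⁺◅◅_

    _◅◅⁺_ : J ⇝* K → K ⇝⁺ L → J ⇝⁺ L
    ε       ◅◅⁺ q = q
    (g ◅ p) ◅◅⁺ q = g ∷ (p ◅◅⁺ q)

    _⁺◅◅_ : J ⇝⁺ K → K ⇝* L → J ⇝⁺ L
    p ⁺◅◅ ε       = p
    p ⁺◅◅ (g ◅ q) = (p ∷ʳ g) ⁺◅◅ q

    ⁺⇒* : J ⇝⁺ K → J ⇝* K
    ⁺⇒* [ g ]   = g ◅ ε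
    ⁺⇒* (g ∷ p) = g ◅ ⁺⇒* p

    -- Weights are functions, so the shadow of I_t agrees with I_t only pointwise;
    -- redirecting the last slide of a nonempty path makes the path end at I_t itself.
    retarget : J ⇝⁺ K → K ≗ L → IsGIS G k L → BHGood G L → J ⇝⁺ L
    retarget [ (gJ , _ , u , v , s) , bJ , _ ] K≗L gL bL =
      [ (gJ , gL , u , v , slideAlong-≗ s K≗L) , bJ , bL ]
    retarget (g ∷ p) K≗L gL bL = g ∷ retarget p K≗L gL bL

    ⁺⇒SlideSeq : J ⇝⁺ K → ∃[ seq ] (SlideSeq G k J seq K × All (BHGood G) seq)
    ⁺⇒SlideSeq [ s@(_ , gK , _) , bJ , bK ] = _ , step s (done gK) , bJ ∷ bK ∷ []
    ⁺⇒SlideSeq ((s , bJ , _) ∷ p) with ⁺⇒SlideSeq p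
    ... | seq , slides , good = _ , step s slides , bJ ∷ good

    parked-Slide : IsGIS G k I → IsGIS G k I' → Parked I M J → Parked I' M' J' →
                   SlideAlong G J u v J' → Slide G k J J'
    parked-Slide gI gI' P P' s = parked-IsGIS gI P , parked-IsGIS gI' P' , _ , _ , s

    park : IsGIS G k I → Parked I M J → BHGood G J → ClearOutside (x ∷ Xs) J →
           ∃₂ λ J' M' → Parked I M' J' × BHGood G J' × ClearOutside Xs J' × J ⇝* J'
    park {M = M} {J} {x} gI P bJ clear with exposed? x | J x in Jx
    ... | no ¬ex | _    = J , M , P , bJ , ClearOutside-∷ clear (⊥-elim ∘ ¬ex) (λ _ _ _ → refl) , ε
    ... | yes _  | zero = J , M , P , bJ , ClearOutside-∷ clear (λ _ → Jx) (λ _ _ _ → refl) , ε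
    ... | yes (px , β , bβ , βx) | suc _ =
      moved x β J , _ , P' , bJ' , clear' , (parked-Slide gI gI P P' s , bJ , bJ') ◅ ε
      where
      s : SlideAlong G J x β (moved x β J)
      s = moved-slideAlong (Adj-sym βx) (subst (1 ≤_) (sym Jx) (s≤s z≤n))
      P' : Parked _ ((x , β) ∷ M) (moved x β J)
      P' = parked-park P (px , bβ , βx) s
      bJ' : BHGood G (moved x β J)
      bJ' = BHGood-⊑ (parking-⊑ s bβ) bJ
      clear' : ClearOutside _ (moved x β J)
      clear' = ClearOutside-∷ clear (λ _ → slideAlong-empties-planet (parked-IsGIS gI P) px s)
                                    (parking-frame s bβ)

    clear-all : IsGIS G k I → Parked I M J → BHGood G J → (Xs : List (Fin n)) → ClearOutside Xs J →
                ∃₂ λ J' M' → Parked I M' J' × Clear J' × J ⇝* J'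
    clear-all gI P bJ []       clear = _ , _ , P , clear , ε
    clear-all gI P bJ (x ∷ Xs) clear with park gI P bJ clear
    ... | _ , _ , P₁ , bJ₁ , clear₁ , path₁ with clear-all gI P₁ bJ₁ Xs clear₁
    ... | J₂ , M₂ , P₂ , clear₂ , path₂ = J₂ , M₂ , P₂ , clear₂ , path₁ ◅◅ path₂

    fetch : IsGIS G k I → Parked I M J → Clear J → 1 ≤ I u →
            ∃₂ λ J' M' → Parked I M' J' × ClearOutside (u ∷ []) J' × 1 ≤ J' u × J ⇝* J'
    fetch {J = J} {u = u} gI P clear 1≤Iu with J u in Ju
    ... | suc _ = J , _ , P , (λ p ex _ → clear p ex λ ()) , subst (1 ≤_) (sym Ju) (s≤s z≤n) , ε
    ... | zero with parked-departure P (parked-missing P Ju 1≤Iu)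
    ...   | b , _ , Pb =
      moved b u J , _ , P' , clear' , subst (1 ≤_) (sym (slideAlong-target s)) (s≤s z≤n) ,
      (parked-Slide gI gI P P' s , Clear⇒BHGood clear , ClearOutside-∷[]⇒BHGood clear') ◅ ε
      where
      s : SlideAlong G J b u (moved b u J)
      s = unparking-slideAlong Pb
      P' : Parked _ _ (moved b u J)
      P' = parked-unpark Pb s
      clear' : ClearOutside (u ∷ []) (moved b u J)
      clear' p ex p∉u = trans (slideAlong-frame s p p≢b (p∉u ∘ here)) (clear p ex λ ())
        where
        p≢b : p ≢ b
        p≢b = Planet⇒≢BlackHole (proj₁ ex) (proj₁ (proj₂ (parked-head Pb)))

    follow : IsGIS G k I → IsGIS G k I' → SlideAlong G I u v I' →
             Parked I M J → ClearOutside (u ∷ []) J → 1 ≤ J u →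
             Parked I' M (moved u v J) × ClearOutside (v ∷ []) (moved u v J) × GoodSlide J (moved u v J)
    follow {u = u} {v} {J = J} gI gI' sI P clear 1≤Ju =
      P' , clear' ,
      (parked-Slide gI gI' P P' s , ClearOutside-∷[]⇒BHGood clear , ClearOutside-∷[]⇒BHGood clear')
      where
      s : SlideAlong G J u v (moved u v J)
      s = moved-slideAlong (proj₁ sI) 1≤Ju
      P' : Parked _ _ (moved u v J)
      P' = parked-slide P sI s
      clear' : ClearOutside (v ∷ []) (moved u v J)
      clear' p ex p∉v with p ≟ u
      ... | yes refl = slideAlong-empties-planet (parked-IsGIS gI P) (proj₁ ex) s
      ... | no p≢u   = trans (slideAlong-frame s p p≢u (p∉v ∘ here)) (clear p ex (∉-∷ p≢u λ ()))

    simulate-slide : Slide G k I I' → Parked I M J → Clear J →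
                     ∃₂ λ J' M' → Parked I' M' J' × Clear J' × J ⇝⁺ J'
    simulate-slide (gI , gI' , u , v , sI) P clear with fetch gI P clear (proj₁ (proj₂ sI))
    ... | _ , _ , P₁ , clear₁ , 1≤J₁u , path₁ with follow gI gI' sI P₁ clear₁ 1≤J₁u
    ... | P₂ , clear₂ , slide₂
        with clear-all gI' P₂ (ClearOutside-∷[]⇒BHGood clear₂) (v ∷ []) clear₂
    ... | J₃ , M₃ , P₃ , clear₃ , path₃ =
      J₃ , M₃ , P₃ , clear₃ , path₁ ◅◅⁺ ([ slide₂ ] ⁺◅◅ path₃)

    simulate : ∀ {is} → SlideSeq G k I is T → Parked I M J → Clear J →
               ∃₂ λ J' M' → Parked T M' J' × J ⇝* J'
    simulate (done _)      P clear = _ , _ , P , ε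
    simulate (step s rest) P clear with simulate-slide s P clear
    ... | _ , _ , P₁ , clear₁ , path₁ with simulate rest P₁ clear₁
    ... | J₂ , M₂ , P₂ , path₂ = J₂ , M₂ , P₂ , ⁺⇒* path₁ ◅◅ path₂

    unpark-all : IsGIS G k T → BHGood G T → Parked T M J → ∃[ J' ] (J' ≗ T × J ⇝* J')
    unpark-all {M = []}            gT bT P = _ , parked-[] P , ε
    unpark-all {M = (p , b) ∷ M} {J = J} gT bT P =
      let J' , J'≗T , path = unpark-all gT bT P'
      in  J' , J'≗T , (parked-Slide gT gT P P' s , parked-BHGood bT P , parked-BHGood bT P') ◅ path
      where
      s : SlideAlong G J b p (moved b p J)
      s = unparking-slideAlong P
      P' : Parked _ M (moved b p J)
      P' = parked-unpark P s

lemma8 : ∀ {n} (G : GalacticGraph n) (k : ℕ) (Is It : Weight n) →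
         IsGIS G k Is → IsGIS G k It →
         BHGood G Is → BHGood G It →
         (∃[ seq ] SlideSeq G k Is seq It) →
         ∃[ seq ] (SlideSeq G k Is seq It × All (BHGood G) seq)
lemma8 G k Is .Is gIs gIt bIs bIt (_ , done _) = _ , done gIs , bIs ∷ []
lemma8 {n} G k Is It gIs gIt bIs bIt (_ , step s rest) =
  let _ , _ , P₀ , clear₀ , path₀ = clear-all gIs parked-refl bIs (allFin n) everything-listed
      _ , _ , P₁ , clear₁ , path₁ = simulate-slide s P₀ clear₀
      _ , _ , P₂ , path₂          = simulate rest P₁ clear₁
      _ , J≗It , path₃            = unpark-all gIt bIt P₂
  in  ⁺⇒SlideSeq (retarget ((path₀ ◅◅⁺ path₁) ⁺◅◅ (path₂ ◅◅ path₃)) J≗It gIt bIt)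
  where
  open Parking G
  open Simulation k
  everything-listed : ClearOutside (allFin n) Is
  everything-listed p _ p∉ = ⊥-elim (p∉ (∈-allFin p))
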